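{- For every graph $G$, let $\Delta^*$ be the smallest possible maximum degree of a spanning forest of $G$. Then $\Delta^*\le DS_{f_{\mathrm{sf}}}(G)+1$.
   Context: Graphs are finite, undirected and unweighted. A spanning forest of $G$ is a forest subgraph on vertex set $V(G)$ with the same connected components as $G$. $f_{\mathrm{sf}}(G)$ is the number of edges of a spanning forest of $G$. Two graphs are node-neighbors if one is obtained from the other by deleting one vertex and its incident edges. $H\preceq H'$ means $H$ is an induced subgraph of $H'$. The down-sensitivity is $DS_f(G)=\max\{|f(H')-f(H)| : H\preceq H'\preceq G,\ H,H' \text{ node-neighbors}\}$. -}

module Defs where

open import Data.Nat using (ℕ; zero; suc; _+_; _≤_; _<ᵇ_)
open import Data.Bool using (Bool; true; false; _∧_; not; if_then_else_)
open import Data.Fin using (Fin; toℕ; _≟_)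
import Data.Fin as F
open import Data.List using (List; _∷_; []; _++_; length)
open import Data.List.Relation.Unary.Linked using (Linked)
open import Data.List.Relation.Unary.Unique.Propositional using (Unique)
open import Relation.Binary.PropositionalEquality using (_≡_)
open import Relation.Binary.Construct.Closure.ReflexiveTransitive using (Star)
open import Relation.Nullary using (¬_)
open import Relation.Nullary.Decidable using (⌊_⌋)
open import Function.Bundles using (_⇔_)

record Graph (n : ℕ) : Set where
  field
    Adj    : Fin n → Fin n → Bool
    sym    : ∀ i j → Adj i j ≡ Adj j i
    irrefl : ∀ i → Adj i i ≡ false
open Graph public

VSet : ℕ → Set
VSet n = Fin n → Bool

ERel : ℕ → Set
ERel n = Fin n → Fin n → Bool

countᶠ : ∀ {n} → (Fin n → Bool) → ℕ
countᶠ {zero}  f = 0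
countᶠ {suc n} f = (if f F.zero then 1 else 0) + countᶠ (λ i → f (F.suc i))

sumᶠ : ∀ {n} → (Fin n → ℕ) → ℕ
sumᶠ {zero}  f = 0
sumᶠ {suc n} f = f F.zero + sumᶠ (λ i → f (F.suc i))

numEdges : ∀ {n} → ERel n → ℕ
numEdges R = sumᶠ (λ i → countᶠ (λ j → (toℕ i <ᵇ toℕ j) ∧ R i j))

deg : ∀ {n} → ERel n → Fin n → ℕ
deg R v = countᶠ (R v)

induced : ∀ {n} → Graph n → VSet n → ERel n
induced G S i j = S i ∧ S j ∧ Adj G i j

full : ∀ {n} → VSet n
full _ = true

delete : ∀ {n} → VSet n → Fin n → VSet n
delete S v u = S u ∧ not ⌊ u ≟ v ⌋

Connected : ∀ {n} → ERel n → Fin n → Fin n → Set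
Connected R = Star (λ a b → R a b ≡ true)

Acyclic : ∀ {n} → ERel n → Set
Acyclic {n} R = ∀ (x : Fin n) (xs : List (Fin n)) → 2 ≤ length xs → Unique (x ∷ xs)
  → ¬ Linked (λ a b → R a b ≡ true) (x ∷ xs ++ x ∷ [])

record IsSpanningForest {n} (S : VSet n) (R : ERel n) (F : ERel n) : Set where
  field
    symF    : ∀ i j → F i j ≡ F j i
    subF    : ∀ i j → F i j ≡ true → R i j ≡ true
    acyclic : Acyclic F
    comps   : ∀ u v → S u ≡ true → S v ≡ true → (Connected R u v ⇔ Connected F u v)

SpanningForestOf : ∀ {n} → Graph n → VSet n → ERel n → Set
SpanningForestOf G S F = IsSpanningForest S (induced G S) F

{-# OPTIONS --safe #-}
-- A normal spanning forest of G is a rooted spanning forest in which every edge of G joins a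
-- vertex to one of its ancestors. There the set T of descendants of a vertex u, and T ∖ u, are
-- closed under taking descendants, so the forest restricted to either of them is a spanning forest
-- of the induced subgraph: the tree path between the ends of an induced edge never leaves the set.
-- The two restrictions differ exactly in the edges from u to its children, so the hypothesis
-- bounds the number of children by D, and the only other forest neighbour of u is its parent.
-- A normal spanning forest of G[S] is built by induction on |S|: remove a vertex r of least
-- priority, build one for S ∖ r under priorities that put the neighbours of r first, so that every
-- tree meeting the neighbourhood of r is rooted in it, and hang those trees below r. The invariant
-- is that every root has least priority in its tree.

module Submission where

open import Defs
open import Data.Nat using (ℕ; _≤_; ∣_-_∣; suc)
open import Data.Bool using (true)
open import Data.Fin using (Fin)
open import Data.Product using (Σ; _×_)
open import Relation.Binary.PropositionalEquality using (_≡_)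

open import Algebra.Properties.CommutativeSemigroup using (interchange)
open import Data.Bool using (Bool; false; _∧_; _∨_; not; if_then_else_; T)
open import Data.Bool.Properties using (∧-zeroʳ; ∧-identityʳ; ∨-comm; ¬-not)
open import Data.Bool.Solver using (module ∨-∧-Solver)
open import Data.Empty using (⊥-elim)
open import Data.Fin using (zero; suc; toℕ; _≟_)
open import Data.Fin.Properties using (toℕ-injective)
open import Data.List using (List; []; _∷_; _++_)
open import Data.List.Relation.Unary.All as All using (All; []; _∷_)
open import Data.List.Relation.Unary.All.Properties using (∷ʳ⁻)
open import Data.List.Relation.Unary.AllPairs as AllPairs using ([]; _∷_)
open import Data.List.Relation.Unary.Linked as Linked using (Linked; []; [-]; _∷_)
open import Data.List.Relation.Unary.Linked.Properties using (Linked⇒AllPairs)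
open import Data.List.Relation.Unary.Unique.Propositional using (Unique)
open import Data.Maybe using (Maybe; just; nothing; is-nothing)
open import Data.Maybe.Properties using (just-injective)
open import Data.Nat using (zero; _+_; _<_; _<ᵇ_; z≤n; s≤s; s≤s⁻¹; _≤?_)
open import Data.Nat.Properties hiding (_≟_)
open import Data.Product using (_,_; proj₁; proj₂)
open import Data.Sum as Sum using (_⊎_; inj₁; inj₂)
open import Data.Unit using (⊤; tt)
open import Function using (_∘_; id; case_of_)
open import Function.Bundles using (mk⇔)
open import Relation.Binary.Construct.Closure.ReflexiveTransitive as Star using (Star; ε; _◅_; _◅◅_)
open import Relation.Binary.Definitions using (Transitive)
open import Relation.Binary.PropositionalEquality as ≡ using (refl; trans; cong; cong₂; subst; module ≡-Reasoning)
open import Relation.Nullary using (Dec; yes; no; ¬_; contradiction)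
open import Relation.Nullary.Decidable using (⌊_⌋; dec-true; isYes≗does; ⌊⌋-map′)

⌊⌋-sound : ∀ {A : Set} (a? : Dec A) → ⌊ a? ⌋ ≡ true → A
⌊⌋-sound (yes a) _ = a

⌊⌋-complete : ∀ {A : Set} (a? : Dec A) → A → ⌊ a? ⌋ ≡ true
⌊⌋-complete a? a = trans (isYes≗does a?) (dec-true a? a)

∧-true : ∀ {a b} → a ∧ b ≡ true → a ≡ true × b ≡ true
∧-true {true} b≡true = refl , b≡true

fromBool : Bool → ℕ
fromBool b = if b then 1 else 0

sumᶠ-cong : ∀ {n} {f g : Fin n → ℕ} → (∀ i → f i ≡ g i) → sumᶠ f ≡ sumᶠ g
sumᶠ-cong {zero}  f≗g = refl
sumᶠ-cong {suc n} f≗g = cong₂ _+_ (f≗g zero) (sumᶠ-cong (f≗g ∘ suc))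

sumᶠ-mono-≤ : ∀ {n} {f g : Fin n → ℕ} → (∀ i → f i ≤ g i) → sumᶠ f ≤ sumᶠ g
sumᶠ-mono-≤ {zero}  f≤g = z≤n
sumᶠ-mono-≤ {suc n} f≤g = +-mono-≤ (f≤g zero) (sumᶠ-mono-≤ (f≤g ∘ suc))

sumᶠ-distrib-+ : ∀ {n} (f g : Fin n → ℕ) → sumᶠ (λ i → f i + g i) ≡ sumᶠ f + sumᶠ g
sumᶠ-distrib-+ {zero}  f g = refl
sumᶠ-distrib-+ {suc n} f g =
  trans (cong (f zero + g zero +_) (sumᶠ-distrib-+ (f ∘ suc) (g ∘ suc)))
        (interchange +-commutativeSemigroup (f zero) (g zero) _ _)

sumᶠ-zero : ∀ n → sumᶠ {n} (λ _ → 0) ≡ 0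
sumᶠ-zero zero    = refl
sumᶠ-zero (suc n) = sumᶠ-zero n

sumᶠ-if : ∀ {n} (b : Bool) (f : Fin n → ℕ) → sumᶠ (λ i → if b then f i else 0) ≡ (if b then sumᶠ f else 0)
sumᶠ-if     true  f = refl
sumᶠ-if {n} false f = sumᶠ-zero n

sumᶠ-at : ∀ {n} (u : Fin n) (f : Fin n → ℕ) → sumᶠ (λ i → if ⌊ i ≟ u ⌋ then f i else 0) ≡ f u
sumᶠ-at {suc n} zero    f = trans (cong (f zero +_) (sumᶠ-zero n)) (+-identityʳ (f zero))
sumᶠ-at {suc n} (suc u) f =
  trans (sumᶠ-cong (λ i → cong (λ b → if b then f (suc i) else 0) (⌊⌋-map′ _ _ (i ≟ u))))
        (sumᶠ-at u (f ∘ suc))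

countᶠ≡sumᶠ : ∀ {n} (f : Fin n → Bool) → countᶠ f ≡ sumᶠ (fromBool ∘ f)
countᶠ≡sumᶠ {zero}  f = refl
countᶠ≡sumᶠ {suc n} f = cong (fromBool (f zero) +_) (countᶠ≡sumᶠ (f ∘ suc))

countᶠ-cong : ∀ {n} {f g : Fin n → Bool} → (∀ i → f i ≡ g i) → countᶠ f ≡ countᶠ g
countᶠ-cong {zero}  f≗g = refl
countᶠ-cong {suc n} f≗g = cong₂ _+_ (cong fromBool (f≗g zero)) (countᶠ-cong (f≗g ∘ suc))

countᶠ-mono : ∀ {n} {f g : Fin n → Bool} → (∀ i → f i ≡ true → g i ≡ true) → countᶠ f ≤ countᶠ g
countᶠ-mono {zero}          f⇒g = z≤n
countᶠ-mono {suc n} {f} {g} f⇒g = +-mono-≤ head (countᶠ-mono (f⇒g ∘ suc))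
  where
  head : fromBool (f zero) ≤ fromBool (g zero)
  head with f zero in f₀
  ... | false = z≤n
  ... | true rewrite f⇒g zero f₀ = ≤-refl

countᶠ-∨ : ∀ {n} (f g : Fin n → Bool) → countᶠ (λ i → f i ∨ g i) ≤ countᶠ f + countᶠ g
countᶠ-∨ f g = begin
  countᶠ (λ i → f i ∨ g i)                     ≡⟨ countᶠ≡sumᶠ (λ i → f i ∨ g i) ⟩
  sumᶠ (λ i → fromBool (f i ∨ g i))            ≤⟨ sumᶠ-mono-≤ (λ i → fromBool-∨ (f i) (g i)) ⟩
  sumᶠ (λ i → fromBool (f i) + fromBool (g i)) ≡⟨ sumᶠ-distrib-+ (fromBool ∘ f) (fromBool ∘ g) ⟩
  sumᶠ (fromBool ∘ f) + sumᶠ (fromBool ∘ g)    ≡⟨ ≡.sym (cong₂ _+_ (countᶠ≡sumᶠ f) (countᶠ≡sumᶠ g)) ⟩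
  countᶠ f + countᶠ g                          ∎
  where
  open ≤-Reasoning
  fromBool-∨ : ∀ a b → fromBool (a ∨ b) ≤ fromBool a + fromBool b
  fromBool-∨ false b = ≤-refl
  fromBool-∨ true  b = m≤m+n 1 (fromBool b)

countᶠ-false : ∀ n → countᶠ {n} (λ _ → false) ≡ 0
countᶠ-false zero    = refl
countᶠ-false (suc n) = countᶠ-false n

countᶠ-≟ : ∀ {n} (u : Fin n) → countᶠ (λ i → ⌊ i ≟ u ⌋) ≡ 1
countᶠ-≟ u = trans (countᶠ≡sumᶠ (λ i → ⌊ i ≟ u ⌋)) (sumᶠ-at u (λ _ → 1))

delete-⊆ : ∀ {n} (S : VSet n) v {w} → delete S v w ≡ true → S w ≡ true
delete-⊆ S v = proj₁ ∘ ∧-true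

delete-≢ : ∀ {n} (S : VSet n) v {w} → delete S v w ≡ true → ¬ w ≡ v
delete-≢ S v {w} w∈ with w ≟ v
... | yes _   = case proj₂ (∧-true {S w} w∈) of λ ()
... | no  w≢v = w≢v

delete-intro : ∀ {n} (S : VSet n) v {w} → S w ≡ true → ¬ w ≡ v → delete S v w ≡ true
delete-intro S v {w} Sw w≢v with w ≟ v
... | yes w≡v = contradiction w≡v w≢v
... | no  _   rewrite Sw = refl

delete-suc : ∀ {n} (S : VSet (suc n)) r i → delete S (suc r) (suc i) ≡ delete (S ∘ suc) r i
delete-suc S r i = cong (λ b → S (suc i) ∧ not b) (⌊⌋-map′ _ _ (i ≟ r))

countᶠ-delete : ∀ {n} (S : VSet n) {r} → S r ≡ true → suc (countᶠ (delete S r)) ≡ countᶠ S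
countᶠ-delete S {zero} Sr rewrite Sr = cong suc (countᶠ-cong (λ i → ∧-identityʳ (S (suc i))))
countᶠ-delete S {suc r} Sr with S zero
... | false = trans (cong suc (countᶠ-cong (delete-suc S r))) (countᶠ-delete (S ∘ suc) Sr)
... | true  = cong suc (trans (cong suc (countᶠ-cong (delete-suc S r))) (countᶠ-delete (S ∘ suc) Sr))

restrict : ∀ {n} → VSet n → ERel n → ERel n
restrict S R i j = S i ∧ S j ∧ R i j

restrict-intro : ∀ {n} {S : VSet n} {R : ERel n} {i j} →
                 S i ≡ true → S j ≡ true → R i j ≡ true → restrict S R i j ≡ true
restrict-intro Si Sj Rij rewrite Si | Sj = Rij

restrict-elim : ∀ {n} {S : VSet n} {R : ERel n} {i j} →
                restrict S R i j ≡ true → S i ≡ true × S j ≡ true × R i j ≡ true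
restrict-elim {S = S} {i = i} e with ∧-true {S i} e
... | Si , e′ = Si , ∧-true e′

restrict-sym : ∀ {n} (S : VSet n) {R : ERel n} → (∀ i j → R i j ≡ R j i) →
               ∀ i j → restrict S R i j ≡ restrict S R j i
restrict-sym S {R} R-sym i j rewrite R-sym i j = ∧-swap (S i) (S j) (R j i)
  where
  open ∨-∧-Solver
  ∧-swap : ∀ a b c → a ∧ b ∧ c ≡ b ∧ a ∧ c
  ∧-swap = solve 3 (λ a b c → a :* (b :* c) := b :* (a :* c)) refl

restrict-irrefl : ∀ {n} (S : VSet n) {R : ERel n} {u} → R u u ≡ false → restrict S R u u ≡ false
restrict-irrefl S {u = u} Ruu rewrite Ruu | ∧-zeroʳ (S u) = ∧-zeroʳ (S u)

restrict-restrict : ∀ {n} (S T : VSet n) (R : ERel n) i j →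
                    restrict S (restrict T R) i j ≡ restrict (λ w → T w ∧ S w) R i j
restrict-restrict S T R i j = ∧-interchange (S i) (S j) (T i) (T j) (R i j)
  where
  open ∨-∧-Solver
  ∧-interchange : ∀ a b c d r → a ∧ b ∧ (c ∧ d ∧ r) ≡ (c ∧ a) ∧ (d ∧ b) ∧ r
  ∧-interchange = solve 5 (λ a b c d r → a :* (b :* (c :* (d :* r))) := (c :* a) :* ((d :* b) :* r)) refl

numEdges-cong : ∀ {n} {R Q : ERel n} → (∀ i j → R i j ≡ Q i j) → numEdges R ≡ numEdges Q
numEdges-cong R≗Q = sumᶠ-cong (λ i → countᶠ-cong (λ j → cong ((toℕ i <ᵇ toℕ j) ∧_) (R≗Q i j)))

<ᵇ-exclusive : ∀ {n} {i j : Fin n} → ¬ i ≡ j →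
               fromBool (toℕ i <ᵇ toℕ j) + fromBool (toℕ j <ᵇ toℕ i) ≡ 1
<ᵇ-exclusive {i = i} {j} i≢j with toℕ i <ᵇ toℕ j in i<j | toℕ j <ᵇ toℕ i in j<i
... | true  | true  = ⊥-elim (<-asym (<ᵇ⇒< (toℕ i) (toℕ j) (subst T (≡.sym i<j) tt))
                                     (<ᵇ⇒< (toℕ j) (toℕ i) (subst T (≡.sym j<i) tt)))
... | true  | false = refl
... | false | true  = refl
... | false | false = ⊥-elim (i≢j (toℕ-injective (≤-antisym (≮⇒≥ (subst T j<i ∘ <⇒<ᵇ))
                                                           (≮⇒≥ (subst T i<j ∘ <⇒<ᵇ)))))

-- An edge {i, j}, i < j, is counted once on the right: away from u, or at its end equal to u.
numEdges-split : ∀ {n} (R : ERel n) (u : Fin n) → (∀ i j → R i j ≡ R j i) → R u u ≡ false →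
                 numEdges R ≡ numEdges (restrict (delete full u) R) + deg R u
numEdges-split {n} R u R-sym Ruu = begin
  numEdges R
    ≡⟨ sumᶠ-cong (λ i → countᶠ≡sumᶠ (edge R i)) ⟩
  ΣΣ (λ i j → fromBool (edge R i j))
    ≡⟨ sumᶠ-cong (λ i → sumᶠ-cong (split i)) ⟩
  ΣΣ (λ i j → away i j + (fromU i j + toU i j))
    ≡⟨ trans (ΣΣ-distrib-+ away _) (cong (ΣΣ away +_) (ΣΣ-distrib-+ fromU toU)) ⟩
  ΣΣ away + (ΣΣ fromU + ΣΣ toU)
    ≡⟨ cong₂ _+_ (sumᶠ-cong (λ i → ≡.sym (countᶠ≡sumᶠ (edge R′ i)))) (cong₂ _+_ fromU-total toU-total) ⟩
  numEdges R′ + (sumᶠ aboveU + sumᶠ belowU)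
    ≡⟨ cong (numEdges R′ +_) (trans (≡.sym (sumᶠ-distrib-+ aboveU belowU)) (sumᶠ-cong mirror)) ⟩
  numEdges R′ + sumᶠ (fromBool ∘ R u)
    ≡⟨ cong (numEdges R′ +_) (≡.sym (countᶠ≡sumᶠ (R u))) ⟩
  numEdges R′ + deg R u ∎
  where
  open ≡-Reasoning
  ΣΣ : (Fin n → Fin n → ℕ) → ℕ
  ΣΣ f = sumᶠ (λ i → sumᶠ (f i))

  ΣΣ-distrib-+ : ∀ f g → ΣΣ (λ i j → f i j + g i j) ≡ ΣΣ f + ΣΣ g
  ΣΣ-distrib-+ f g = trans (sumᶠ-cong (λ i → sumᶠ-distrib-+ (f i) (g i)))
                           (sumᶠ-distrib-+ (λ i → sumᶠ (f i)) (λ i → sumᶠ (g i)))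

  R′ : ERel n
  R′ = restrict (delete full u) R
  edge : ERel n → ERel n
  edge Q i j = (toℕ i <ᵇ toℕ j) ∧ Q i j
  aboveU belowU : Fin n → ℕ
  aboveU j = fromBool (edge R u j)
  belowU j = fromBool (edge R j u)
  away fromU toU : Fin n → Fin n → ℕ
  away  i j = fromBool (edge R′ i j)
  fromU i j = if ⌊ i ≟ u ⌋ then fromBool (edge R i j) else 0
  toU   i j = if ⌊ j ≟ u ⌋ then fromBool (edge R i j) else 0

  split : ∀ i j → fromBool (edge R i j) ≡ away i j + (fromU i j + toU i j)
  split i j with i ≟ u | j ≟ u | toℕ i <ᵇ toℕ j
  ... | yes refl | yes refl | b     rewrite Ruu | ∧-zeroʳ b = refl
  ... | yes _    | no _     | false = refl
  ... | yes _    | no _     | true  = ≡.sym (+-identityʳ _)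
  ... | no _     | yes _    | false = refl
  ... | no _     | yes _    | true  = refl
  ... | no _     | no _     | false = refl
  ... | no _     | no _     | true  = ≡.sym (+-identityʳ _)

  fromU-total : ΣΣ fromU ≡ sumᶠ aboveU
  fromU-total = trans (sumᶠ-cong (λ i → sumᶠ-if ⌊ i ≟ u ⌋ (λ j → fromBool (edge R i j))))
                      (sumᶠ-at u (λ i → sumᶠ (λ j → fromBool (edge R i j))))

  toU-total : ΣΣ toU ≡ sumᶠ belowU
  toU-total = sumᶠ-cong (λ i → sumᶠ-at u (λ j → fromBool (edge R i j)))

  mirror : ∀ j → aboveU j + belowU j ≡ fromBool (R u j)
  mirror j with j ≟ u
  ... | yes refl rewrite Ruu | ∧-zeroʳ (toℕ j <ᵇ toℕ j) = refl
  ... | no j≢u rewrite R-sym j u with R u j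
  ...   | false rewrite ∧-zeroʳ (toℕ u <ᵇ toℕ j) | ∧-zeroʳ (toℕ j <ᵇ toℕ u) = refl
  ...   | true  rewrite ∧-identityʳ (toℕ u <ᵇ toℕ j) | ∧-identityʳ (toℕ j <ᵇ toℕ u) =
    <ᵇ-exclusive (j≢u ∘ ≡.sym)

Acyclic-⊆ : ∀ {n} {R Q : ERel n} → (∀ i j → R i j ≡ true → Q i j ≡ true) → Acyclic Q → Acyclic R
Acyclic-⊆ R⊆Q Q-acyclic x xs 2≤∣xs∣ unique cycle =
  Q-acyclic x xs 2≤∣xs∣ unique (Linked.map (R⊆Q _ _) cycle)

lastOf : ∀ {A : Set} → A → List A → A
lastOf a []      = a
lastOf a (b ∷ l) = lastOf b l

All-lastOf : ∀ {A : Set} {P : A → Set} {b} l → All P (b ∷ l) → P (lastOf b l)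
All-lastOf []      (pb ∷ _)  = pb
All-lastOf (c ∷ l) (_ ∷ pcl) = All-lastOf l pcl

Linked-lastOf : ∀ {A : Set} {R : A → A → Set} {a z} l → Linked R (a ∷ l ++ z ∷ []) → R (lastOf a l) z
Linked-lastOf []      (r ∷ _) = r
Linked-lastOf (b ∷ l) (_ ∷ L) = Linked-lastOf l L

Linked-ends : ∀ {A : Set} {R : A → A → Set} → Transitive R →
              ∀ {a z} l → Linked R (a ∷ l ++ z ∷ []) → R a z
Linked-ends R-trans l L with Linked⇒AllPairs R-trans L
... | Ra ∷ _ = proj₂ (∷ʳ⁻ {xs = l} Ra)

NonBacktracking : ∀ {A : Set} → List A → Set
NonBacktracking (a ∷ b ∷ c ∷ l) = ¬ a ≡ c × NonBacktracking (b ∷ c ∷ l)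
NonBacktracking _               = ⊤

NonBacktracking-tail : ∀ {A : Set} {a : A} l → NonBacktracking (a ∷ l) → NonBacktracking l
NonBacktracking-tail []          _        = tt
NonBacktracking-tail (b ∷ [])    _        = tt
NonBacktracking-tail (b ∷ c ∷ l) (_ , nb) = nb

Unique⇒NonBacktracking : ∀ {A : Set} (l : List A) {z} → Unique l → All (λ y → ¬ y ≡ z) l →
                         NonBacktracking (l ++ z ∷ [])
Unique⇒NonBacktracking []              _                      _         = tt
Unique⇒NonBacktracking (a ∷ [])        _                      _         = tt
Unique⇒NonBacktracking (a ∷ b ∷ [])    _                      (a≢z ∷ _) = a≢z , tt
Unique⇒NonBacktracking (a ∷ b ∷ c ∷ l) ((_ ∷ a≢c ∷ _) ∷ uniq) (_ ∷ ≢z)  =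
  a≢c , Unique⇒NonBacktracking (b ∷ c ∷ l) uniq ≢z

DescendsFrom : ∀ {n} → (Fin n → Maybe (Fin n)) → Fin n → Fin n → Set
DescendsFrom parent = Star (λ a b → parent a ≡ just b)

pointsTo : ∀ {n} → Maybe (Fin n) → Fin n → Bool
pointsTo nothing  _ = false
pointsTo (just x) j = ⌊ j ≟ x ⌋

pointsTo-sound : ∀ {n} (m : Maybe (Fin n)) j → pointsTo m j ≡ true → m ≡ just j
pointsTo-sound (just x) j e = cong just (≡.sym (⌊⌋-sound (j ≟ x) e))

pointsTo-complete : ∀ {n} {m : Maybe (Fin n)} {j} → m ≡ just j → pointsTo m j ≡ true
pointsTo-complete {j = j} refl = ⌊⌋-complete (j ≟ j) refl

countᶠ-pointsTo : ∀ {n} (m : Maybe (Fin n)) → countᶠ (pointsTo m) ≤ 1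
countᶠ-pointsTo {n} nothing  = ≤-trans (≤-reflexive (countᶠ-false n)) z≤n
countᶠ-pointsTo     (just x) = ≤-reflexive (countᶠ-≟ x)

module ParentForest {n} (parent : Fin n → Maybe (Fin n)) (depth : Fin n → ℕ)
                    (depth-parent : ∀ {u w} → parent u ≡ just w → depth w < depth u) where

  _⇝_ : Fin n → Fin n → Set
  _⇝_ = DescendsFrom parent

  descends-depth : ∀ {w t} → w ⇝ t → w ≡ t ⊎ depth t < depth w
  descends-depth ε = inj₁ refl
  descends-depth (step ◅ w⇝t) with descends-depth w⇝t
  ... | inj₁ refl = inj₂ (depth-parent step)
  ... | inj₂ lt   = inj₂ (<-trans lt (depth-parent step))

  ⇝-antisym : ∀ {w t} → w ⇝ t → t ⇝ w → w ≡ t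
  ⇝-antisym w⇝t t⇝w with descends-depth w⇝t | descends-depth t⇝w
  ... | inj₁ w≡t | _        = w≡t
  ... | inj₂ _   | inj₁ t≡w = ≡.sym t≡w
  ... | inj₂ t<w | inj₂ w<t = contradiction t<w (<-asym w<t)

  private
    descends-fuel : ∀ k w t → depth w < k → Dec (w ⇝ t)
    descends-fuel (suc k) w t _ with w ≟ t
    ... | yes refl = yes ε
    descends-fuel (suc k) w t lt | no w≢t with parent w in e
    ... | nothing = no λ { ε → w≢t refl ; (step ◅ _) → case trans (≡.sym e) step of λ () }
    ... | just w′ with descends-fuel k w′ t (≤-trans (depth-parent e) (s≤s⁻¹ lt))
    ...   | yes w′⇝t = yes (e ◅ w′⇝t)
    ...   | no  w′⇏t = no λ { ε → w≢t refl
                            ; (step ◅ w″⇝t) → w′⇏t (subst (_⇝ t) (just-injective (trans (≡.sym step) e)) w″⇝t) }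

    root-fuel : ∀ k w → depth w < k → Σ (Fin n) (λ t → w ⇝ t × parent t ≡ nothing)
    root-fuel (suc k) w lt with parent w in e
    ... | nothing = w , ε , e
    ... | just w′ with root-fuel k w′ (≤-trans (depth-parent e) (s≤s⁻¹ lt))
    ...   | t , w′⇝t , t-root = t , e ◅ w′⇝t , t-root

  _⇝?_ : ∀ w t → Dec (w ⇝ t)
  w ⇝? t = descends-fuel (suc (depth w)) w t ≤-refl

  root : ∀ w → Σ (Fin n) (λ t → w ⇝ t × parent t ≡ nothing)
  root w = root-fuel (suc (depth w)) w ≤-refl

  treeEdge : ERel n
  treeEdge i j = pointsTo (parent i) j ∨ pointsTo (parent j) i

  treeEdge-sym : ∀ i j → treeEdge i j ≡ treeEdge j i
  treeEdge-sym i j = ∨-comm (pointsTo (parent i) j) (pointsTo (parent j) i)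

  parent⇒treeEdge : ∀ {i j} → parent i ≡ just j → treeEdge i j ≡ true
  parent⇒treeEdge e rewrite pointsTo-complete e = refl

  child⇒treeEdge : ∀ {i j} → parent j ≡ just i → treeEdge i j ≡ true
  child⇒treeEdge {i} {j} e = trans (treeEdge-sym i j) (parent⇒treeEdge e)

  treeEdge⇒ : ∀ {i j} → treeEdge i j ≡ true → parent i ≡ just j ⊎ parent j ≡ just i
  treeEdge⇒ {i} {j} e with pointsTo (parent i) j in eᵢ
  ... | true  = inj₁ (pointsTo-sound (parent i) j eᵢ)
  ... | false = inj₂ (pointsTo-sound (parent j) i e)

  treeEdge-irrefl : ∀ u → treeEdge u u ≡ false
  treeEdge-irrefl u with treeEdge u u in e
  ... | false = refl
  ... | true with treeEdge⇒ e
  ...   | inj₁ loop = ⊥-elim (<-irrefl refl (depth-parent loop))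
  ...   | inj₂ loop = ⊥-elim (<-irrefl refl (depth-parent loop))

  private
    Up Down TreeStep : Fin n → Fin n → Set
    Up       a b = parent a ≡ just b
    Down     a b = parent b ≡ just a
    TreeStep a b = treeEdge a b ≡ true

  -- A vertex has only one parent, so a non-backtracking walk cannot turn up after going down.
  first-down⇒all-down : ∀ {w₀ w₁} rest → Down w₀ w₁ → Linked TreeStep (w₁ ∷ rest) →
                        NonBacktracking (w₀ ∷ w₁ ∷ rest) → Linked Down (w₀ ∷ w₁ ∷ rest)
  first-down⇒all-down []          down _       _            = down ∷ [-]
  first-down⇒all-down (w₂ ∷ rest) down (e ∷ L) (w₀≢w₂ , nb) with treeEdge⇒ e
  ... | inj₁ up    = ⊥-elim (w₀≢w₂ (just-injective (trans (≡.sym down) up)))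
  ... | inj₂ down′ = down ∷ first-down⇒all-down rest down′ L nb

  last-up⇒all-up : ∀ {a z} l → Linked TreeStep (a ∷ l ++ z ∷ []) → NonBacktracking (a ∷ l ++ z ∷ []) →
                   Up (lastOf a l) z → Linked Up (a ∷ l ++ z ∷ [])
  last-up⇒all-up []      _       _  up = up ∷ [-]
  last-up⇒all-up (b ∷ l) (e ∷ L) nb up with treeEdge⇒ e
  ... | inj₁ up′  = up′ ∷ last-up⇒all-up l L (NonBacktracking-tail (b ∷ l ++ _ ∷ []) nb) up
  ... | inj₂ down = ⊥-elim (<-asym (depth-parent up) (depth-parent last-down))
    where
    last-down : Down (lastOf b l) _
    last-down = Linked-lastOf (b ∷ l) (first-down⇒all-down (l ++ _ ∷ []) down L nb)

  depth-decreases-up : ∀ {a z} l → Linked Up (a ∷ l ++ z ∷ []) → depth z < depth a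
  depth-decreases-up l L = Linked-ends (λ b<a c<b → <-trans c<b b<a) l (Linked.map depth-parent L)

  depth-increases-down : ∀ {a z} l → Linked Down (a ∷ l ++ z ∷ []) → depth a < depth z
  depth-increases-down l L = Linked-ends <-trans l (Linked.map depth-parent L)

  -- A cycle whose first step goes up and whose last step goes down would give its first vertex
  -- two different parents, the second and the last vertex.
  treeEdge-acyclic : Acyclic treeEdge
  treeEdge-acyclic x (x₁ ∷ []) (s≤s ())
  treeEdge-acyclic x (x₁ ∷ x₂ ∷ xs) _ ((x≢x₁ ∷ x≢x₂ ∷ x≢xs) ∷ uniq) = no-cycle
    where
    nb : NonBacktracking (x ∷ x₁ ∷ x₂ ∷ xs ++ x ∷ [])
    nb = x≢x₂ , Unique⇒NonBacktracking (x₁ ∷ x₂ ∷ xs) uniq (All.map (_∘ ≡.sym) (x≢x₁ ∷ x≢x₂ ∷ x≢xs))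

    no-cycle : ¬ Linked TreeStep (x ∷ x₁ ∷ x₂ ∷ xs ++ x ∷ [])
    no-cycle (e ∷ cycle) with treeEdge⇒ e
    ... | inj₂ down =
      <-irrefl refl (depth-increases-down (x₁ ∷ x₂ ∷ xs) (first-down⇒all-down (x₂ ∷ xs ++ x ∷ []) down cycle nb))
    ... | inj₁ up with treeEdge⇒ (Linked-lastOf (x₁ ∷ x₂ ∷ xs) (e ∷ cycle))
    ...   | inj₁ up′  =
      <-irrefl refl (depth-decreases-up (x₁ ∷ x₂ ∷ xs) (last-up⇒all-up (x₁ ∷ x₂ ∷ xs) (e ∷ cycle) nb up′))
    ...   | inj₂ down = All-lastOf xs (AllPairs.head uniq) (just-injective (trans (≡.sym up) down))

record NormalForest {n} (G : Graph n) (S : VSet n) (ρ : Fin n → ℕ) : Set where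
  field
    parent       : Fin n → Maybe (Fin n)
    depth        : Fin n → ℕ
    depth-parent : ∀ {u w} → parent u ≡ just w → depth w < depth u
    parent-in    : ∀ {u w} → parent u ≡ just w → S u ≡ true × S w ≡ true
    parent-adj   : ∀ {u w} → parent u ≡ just w → Adj G u w ≡ true
    normal       : ∀ {a b} → S a ≡ true → S b ≡ true → Adj G a b ≡ true →
                   DescendsFrom parent a b ⊎ DescendsFrom parent b a
    root-min     : ∀ {t} → S t ≡ true → parent t ≡ nothing →
                   ∀ {w} → DescendsFrom parent w t → ρ t ≤ ρ w

  ancestor-in : ∀ {w t} → DescendsFrom parent w t → S w ≡ true → S t ≡ true
  ancestor-in ε         Sw = Sw
  ancestor-in (e ◅ w⇝t) _  = ancestor-in w⇝t (proj₂ (parent-in e))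

argmin : ∀ {n} (S : VSet n) (ρ : Fin n → ℕ) →
         (∀ w → S w ≡ false) ⊎ Σ (Fin n) (λ r → S r ≡ true × (∀ {w} → S w ≡ true → ρ r ≤ ρ w))
argmin {zero}  S ρ = inj₁ λ ()
argmin {suc n} S ρ with S zero in S₀ | argmin (S ∘ suc) (ρ ∘ suc)
... | false | inj₁ empty = inj₁ λ { zero → S₀ ; (suc w) → empty w }
... | false | inj₂ (r , Sr , r-min) =
  inj₂ (suc r , Sr , λ { {zero} Sw → case trans (≡.sym Sw) S₀ of λ () ; {suc w} Sw → r-min Sw })
... | true  | inj₁ empty =
  inj₂ (zero , S₀ , λ { {zero} _ → ≤-refl ; {suc w} Sw → case trans (≡.sym Sw) (empty w) of λ () })
... | true  | inj₂ (r , Sr , r-min) with ρ zero ≤? ρ (suc r)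
...   | yes ρ₀≤ = inj₂ (zero , S₀ , λ { {zero} _ → ≤-refl ; {suc w} Sw → ≤-trans ρ₀≤ (r-min Sw) })
...   | no  ρ₀≰ = inj₂ (suc r , Sr , λ { {zero} _ → <⇒≤ (≰⇒> ρ₀≰) ; {suc w} Sw → r-min Sw })

module NormalForests {n} (G : Graph n) where

  preferNeighbours : Fin n → (Fin n → ℕ) → Fin n → ℕ
  preferNeighbours r ρ w = if Adj G r w then 0 else suc (ρ w)

  prefer≤0⇒adjacent : ∀ {r ρ t} → preferNeighbours r ρ t ≤ 0 → Adj G r t ≡ true
  prefer≤0⇒adjacent {r} {t = t} _ with Adj G r t
  ... | true = refl

  prefer-≤⇒≤ : ∀ {r ρ t w} → Adj G r t ≡ false →
               preferNeighbours r ρ t ≤ preferNeighbours r ρ w → ρ t ≤ ρ w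
  prefer-≤⇒≤ {r} {w = w} not-adj ρ′t≤ρ′w rewrite not-adj with Adj G r w
  ... | false = s≤s⁻¹ ρ′t≤ρ′w

  empty : ∀ {S} ρ → (∀ w → S w ≡ false) → NormalForest G S ρ
  empty ρ S-empty = record
    { parent = λ _ → nothing ; depth = λ _ → 0
    ; depth-parent = λ () ; parent-in = λ () ; parent-adj = λ ()
    ; normal   = λ Sa _ _ → contradiction (trans (≡.sym Sa) (S-empty _)) λ ()
    ; root-min = λ St _ _ → contradiction (trans (≡.sym St) (S-empty _)) λ () }

  module Attach {S : VSet n} {ρ : Fin n → ℕ} {r : Fin n} (Sr : S r ≡ true)
                (r-min : ∀ {w} → S w ≡ true → ρ r ≤ ρ w)
                (old : NormalForest G (delete S r) (preferNeighbours r ρ)) where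

    open NormalForest old renaming
      ( parent to parent′ ; depth to depth′ ; depth-parent to depth-parent′ ; parent-in to parent-in′
      ; parent-adj to parent-adj′ ; normal to normal′ ; root-min to root-min′ ; ancestor-in to ancestor-in′ )

    S′ : VSet n
    S′ = delete S r

    ρ′ : Fin n → ℕ
    ρ′ = preferNeighbours r ρ

    S′-r : S′ r ≡ false
    S′-r with S′ r in e
    ... | true  = contradiction refl (delete-≢ S r e)
    ... | false = refl

    parent′-outside : ∀ {w} → S′ w ≡ false → parent′ w ≡ nothing
    parent′-outside {w} S′w with parent′ w in e
    ... | nothing = refl
    ... | just _  = case trans (≡.sym (proj₁ (parent-in′ e))) S′w of λ ()

    attached : Fin n → Bool
    attached w = S′ w ∧ is-nothing (parent′ w) ∧ Adj G r w

    attached⇒ : ∀ {w} → attached w ≡ true → S′ w ≡ true × parent′ w ≡ nothing × Adj G r w ≡ true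
    attached⇒ {w} e with S′ w | parent′ w
    ... | true | nothing = refl , refl , e

    attached-intro : ∀ {w} → S′ w ≡ true → parent′ w ≡ nothing → Adj G r w ≡ true → attached w ≡ true
    attached-intro S′w root adj rewrite S′w | root | adj = refl

    parent : Fin n → Maybe (Fin n)
    parent w = if attached w then just r else parent′ w

    depth : Fin n → ℕ
    depth w = if S′ w then suc (depth′ w) else 0

    _⇝_ _⇝′_ : Fin n → Fin n → Set
    _⇝_  = DescendsFrom parent
    _⇝′_ = DescendsFrom parent′

    parent-cases : ∀ {w x} → parent w ≡ just x → (attached w ≡ true × x ≡ r) ⊎ parent′ w ≡ just x
    parent-cases {w} e with attached w
    ... | true  = inj₁ (refl , ≡.sym (just-injective e))
    ... | false = inj₂ e

    parent-old : ∀ {w x} → parent′ w ≡ just x → parent w ≡ just x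
    parent-old {w} e with attached w in a
    ... | false = e
    ... | true  = case trans (≡.sym (proj₁ (proj₂ (attached⇒ a)))) e of λ ()

    parent-root : ∀ {w} → parent w ≡ nothing → attached w ≡ false × parent′ w ≡ nothing
    parent-root {w} e with attached w
    ... | false = refl , e

    parent-r : parent r ≡ nothing
    parent-r with attached r in a
    ... | true  = contradiction refl (delete-≢ S r (proj₁ (attached⇒ a)))
    ... | false = parent′-outside S′-r

    parent-in : ∀ {u w} → parent u ≡ just w → S u ≡ true × S w ≡ true
    parent-in e with parent-cases e
    ... | inj₁ (a , refl) = delete-⊆ S r (proj₁ (attached⇒ a)) , Sr
    ... | inj₂ e′         = delete-⊆ S r (proj₁ (parent-in′ e′)) , delete-⊆ S r (proj₂ (parent-in′ e′))

    descends-old : ∀ {w t} → w ⇝′ t → w ⇝ t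
    descends-old = Star.map parent-old

    r-is-root : ∀ {t} → r ⇝ t → t ≡ r
    r-is-root ε       = refl
    r-is-root (e ◅ _) = case trans (≡.sym parent-r) e of λ ()

    descends-new : ∀ {w t} → w ⇝ t → ¬ t ≡ r → w ⇝′ t
    descends-new ε         _   = ε
    descends-new (e ◅ w⇝t) t≢r with parent-cases e
    ... | inj₁ (_ , refl) = contradiction (r-is-root w⇝t) t≢r
    ... | inj₂ e′         = e′ ◅ descends-new w⇝t t≢r

    -- The old root t above b has ρ′ t ≤ ρ′ b = 0, so t is adjacent to r and got attached to r.
    neighbour-descends : ∀ {b} → S′ b ≡ true → Adj G r b ≡ true → b ⇝ r
    neighbour-descends {b} S′b adj with ParentForest.root parent′ depth′ depth-parent′ b
    ... | t , b⇝′t , t-root = descends-old b⇝′t ◅◅ (parent-t ◅ ε)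
      where
      S′t : S′ t ≡ true
      S′t = ancestor-in′ b⇝′t S′b
      ρ′b≡0 : ρ′ b ≡ 0
      ρ′b≡0 rewrite adj = refl
      adj-t : Adj G r t ≡ true
      adj-t = prefer≤0⇒adjacent {ρ = ρ} (subst (ρ′ t ≤_) ρ′b≡0 (root-min′ S′t t-root b⇝′t))
      parent-t : parent t ≡ just r
      parent-t rewrite attached-intro S′t t-root adj-t = refl

    depth-parent : ∀ {u w} → parent u ≡ just w → depth w < depth u
    depth-parent e with parent-cases e
    ... | inj₁ (a , refl) rewrite S′-r | proj₁ (attached⇒ a) = s≤s z≤n
    ... | inj₂ e′ rewrite proj₁ (parent-in′ e′) | proj₂ (parent-in′ e′) = s≤s (depth-parent′ e′)

    parent-adj : ∀ {u w} → parent u ≡ just w → Adj G u w ≡ true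
    parent-adj {u} e with parent-cases e
    ... | inj₁ (a , refl) = trans (sym G u r) (proj₂ (proj₂ (attached⇒ a)))
    ... | inj₂ e′         = parent-adj′ e′

    normal : ∀ {a b} → S a ≡ true → S b ≡ true → Adj G a b ≡ true → a ⇝ b ⊎ b ⇝ a
    normal {a} {b} Sa Sb adj with a ≟ r | b ≟ r
    ... | yes refl | yes refl = case trans (≡.sym adj) (irrefl G a) of λ ()
    ... | yes refl | no b≢r   = inj₂ (neighbour-descends (delete-intro S r Sb b≢r) adj)
    ... | no a≢r   | yes refl = inj₁ (neighbour-descends (delete-intro S r Sa a≢r) (trans (sym G b a) adj))
    ... | no a≢r   | no b≢r   =
      Sum.map descends-old descends-old (normal′ (delete-intro S r Sa a≢r) (delete-intro S r Sb b≢r) adj)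

    root-min : ∀ {t} → S t ≡ true → parent t ≡ nothing → ∀ {w} → w ⇝ t → ρ t ≤ ρ w
    root-min {t} St root {w} w⇝t = by-cases (t ≟ r)
      where
      below-r : ∀ {w} → w ⇝ r → S w ≡ true
      below-r ε       = Sr
      below-r (e ◅ _) = proj₁ (parent-in e)

      by-cases : Dec (t ≡ r) → ρ t ≤ ρ w
      by-cases (yes refl) = r-min (below-r w⇝t)
      by-cases (no t≢r)   = prefer-≤⇒≤ not-adjacent (root-min′ S′t old-root (descends-new w⇝t t≢r))
        where
        S′t : S′ t ≡ true
        S′t = delete-intro S r St t≢r
        old-root : parent′ t ≡ nothing
        old-root = proj₂ (parent-root root)
        not-adjacent : Adj G r t ≡ false
        not-adjacent = ¬-not λ adj →
          case trans (≡.sym (proj₁ (parent-root root))) (attached-intro S′t old-root adj) of λ ()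

    forest : NormalForest G S ρ
    forest = record
      { parent = parent ; depth = depth ; depth-parent = depth-parent ; parent-in = parent-in
      ; parent-adj = parent-adj ; normal = normal ; root-min = root-min }

  normalForest : ∀ k S → countᶠ S ≤ k → ∀ ρ → NormalForest G S ρ
  normalForest k S ∣S∣≤k ρ with argmin S ρ
  ... | inj₁ S-empty = empty ρ S-empty
  ... | inj₂ (r , Sr , r-min) with k | ≤-trans (≤-reflexive (countᶠ-delete S Sr)) ∣S∣≤k
  ...   | suc k′ | s≤s ∣S∖r∣≤k′ = Attach.forest Sr r-min (normalForest k′ (delete S r) ∣S∖r∣≤k′ _)

module TreeEdges {n} {G : Graph n} {ρ : Fin n → ℕ} (nf : NormalForest G full ρ) where

  open NormalForest nf
  open ParentForest parent depth depth-parent public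

  DownClosed : VSet n → Set
  DownClosed S = ∀ {w t} → w ⇝ t → S t ≡ true → S w ≡ true

  treeEdge⇒adjacent : ∀ {i j} → treeEdge i j ≡ true → Adj G i j ≡ true
  treeEdge⇒adjacent {i} {j} e with treeEdge⇒ e
  ... | inj₁ i↑j = parent-adj i↑j
  ... | inj₂ j↑i = trans (sym G i j) (parent-adj j↑i)

  module _ {S : VSet n} (closed : DownClosed S) where

    path-to-ancestor : ∀ {w t} → S t ≡ true → w ⇝ t → Connected (restrict S treeEdge) w t
    path-to-ancestor St ε          = ε
    path-to-ancestor St (e ◅ w′⇝t) =
      restrict-intro {S = S} {treeEdge} (closed (e ◅ w′⇝t) St) (closed w′⇝t St) (parent⇒treeEdge e)
        ◅ path-to-ancestor St w′⇝t

    induced-edge-path : ∀ {a b} → induced G S a b ≡ true → Connected (restrict S treeEdge) a b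
    induced-edge-path e with restrict-elim {S = S} {Adj G} e
    ... | Sa , Sb , adj with normal refl refl adj
    ...   | inj₁ a⇝b = path-to-ancestor Sb a⇝b
    ...   | inj₂ b⇝a = Star.reverse (trans (restrict-sym S treeEdge-sym _ _)) (path-to-ancestor Sa b⇝a)

    restrict-spanningForest : SpanningForestOf G S (restrict S treeEdge)
    restrict-spanningForest = record
      { symF    = restrict-sym S treeEdge-sym
      ; subF    = λ _ _ → sub
      ; acyclic = Acyclic-⊆ (λ _ _ → proj₂ ∘ proj₂ ∘ restrict-elim {S = S} {treeEdge}) treeEdge-acyclic
      ; comps   = λ _ _ _ _ → mk⇔ (Star.kleisliStar id induced-edge-path) (Star.map sub) }
      where
      sub : ∀ {i j} → restrict S treeEdge i j ≡ true → induced G S i j ≡ true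
      sub e with restrict-elim {S = S} {treeEdge} e
      ... | Si , Sj , tree = restrict-intro {S = S} {Adj G} Si Sj (treeEdge⇒adjacent tree)

  full-closed : DownClosed full
  full-closed _ _ = refl

  subtree : Fin n → VSet n
  subtree u w = ⌊ w ⇝? u ⌋

  ∈-subtree : ∀ {u w} → w ⇝ u → subtree u w ≡ true
  ∈-subtree {u} {w} = ⌊⌋-complete (w ⇝? u)

  subtree-closed : ∀ u → DownClosed (subtree u)
  subtree-closed u {t = t} w⇝t t∈ = ∈-subtree (w⇝t ◅◅ ⌊⌋-sound (t ⇝? u) t∈)

  subtree∖root-closed : ∀ u → DownClosed (delete (subtree u) u)
  subtree∖root-closed u {w} {t} w⇝t t∈ = delete-intro (subtree u) u (subtree-closed u w⇝t t∈T) w≢u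
    where
    t∈T : subtree u t ≡ true
    t∈T = delete-⊆ (subtree u) u t∈
    w≢u : ¬ w ≡ u
    w≢u refl = delete-≢ (subtree u) u t∈ (≡.sym (⇝-antisym w⇝t (⌊⌋-sound (t ⇝? u) t∈T)))

  -- The neighbours of u in its subtree are its children; the only other one is its parent.
  deg≤suc-deg-subtree : ∀ u → deg treeEdge u ≤ suc (deg (restrict (subtree u) treeEdge) u)
  deg≤suc-deg-subtree u = begin
    countᶠ (λ j → pointsTo (parent u) j ∨ pointsTo (parent j) u)
      ≤⟨ countᶠ-∨ (pointsTo (parent u)) (λ j → pointsTo (parent j) u) ⟩
    countᶠ (pointsTo (parent u)) + countᶠ (λ j → pointsTo (parent j) u)
      ≤⟨ +-mono-≤ (countᶠ-pointsTo (parent u)) (countᶠ-mono child-in-subtree) ⟩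
    suc (deg (restrict (subtree u) treeEdge) u) ∎
    where
    open ≤-Reasoning
    child-in-subtree : ∀ j → pointsTo (parent j) u ≡ true → restrict (subtree u) treeEdge u j ≡ true
    child-in-subtree j e =
      restrict-intro {S = subtree u} {treeEdge} (∈-subtree ε) (∈-subtree (j↑u ◅ ε)) (child⇒treeEdge j↑u)
      where
      j↑u : parent j ≡ just u
      j↑u = pointsTo-sound (parent j) u e

  subtree-edge-difference :
    ∀ u → ∣ numEdges (restrict (subtree u) treeEdge) - numEdges (restrict (delete (subtree u) u) treeEdge) ∣
          ≡ deg (restrict (subtree u) treeEdge) u
  subtree-edge-difference u = trans (cong ∣_- m ∣ split) (trans (∣-∣-comm (m + k) m) (∣m-m+n∣≡n m k))
    where
    m k : ℕ
    m = numEdges (restrict (delete (subtree u) u) treeEdge)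
    k = deg (restrict (subtree u) treeEdge) u
    split : numEdges (restrict (subtree u) treeEdge) ≡ m + k
    split = trans (numEdges-split _ u (restrict-sym (subtree u) treeEdge-sym)
                                      (restrict-irrefl (subtree u) {treeEdge} (treeEdge-irrefl u)))
                  (cong (_+ k) (numEdges-cong (restrict-restrict (delete full u) (subtree u) treeEdge)))

lemma1p6 : ∀ {n} (G : Graph n) (D : ℕ)
    → (∀ (S' : VSet n) (v : Fin n) → S' v ≡ true → ∀ F F'
         → SpanningForestOf G (delete S' v) F → SpanningForestOf G S' F'
         → ∣ numEdges F' - numEdges F ∣ ≤ D)
    → Σ (ERel n) (λ F → SpanningForestOf G full F × (∀ u → deg F u ≤ suc D))
lemma1p6 {n} G D hyp = treeEdge , restrict-spanningForest full-closed , degree-bound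
  where
  open NormalForests G using (normalForest)
  open TreeEdges (normalForest (countᶠ (full {n})) full ≤-refl (λ _ → 0))

  children≤D : ∀ u → deg (restrict (subtree u) treeEdge) u ≤ D
  children≤D u = subst (_≤ D) (subtree-edge-difference u)
    (hyp (subtree u) u (∈-subtree ε) _ _ (restrict-spanningForest (subtree∖root-closed u))
                                         (restrict-spanningForest (subtree-closed u)))

  degree-bound : ∀ u → deg treeEdge u ≤ suc D
  degree-bound u = ≤-trans (deg≤suc-deg-subtree u) (s≤s (children≤D u))
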